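{- There exist a finite alphabet $A$ of constants, a finite set $V$ of variables, and a quadratic word equation $E$ over $A$ and $V$ whose length abstraction $\mathrm{Len}(E)\subseteq \mathbb{N}^{|V|}$ is not Presburger-definable. -}

module Defs where

open import Data.Nat using (ℕ; zero; suc; _+_; _≤_)
open import Data.Fin using (Fin; zero; suc; _≟_)
open import Data.Sum using (_⊎_; inj₁; inj₂)
open import Data.Product using (_×_; Σ; _,_)
open import Data.List using (List; []; _∷_; _++_; length; concatMap; [_])
open import Relation.Nullary using (¬_; yes; no)
open import Relation.Binary.PropositionalEquality using (_≡_)

-- A symbol is either a constant (inj₁) or a variable (inj₂).
Symbol : ℕ → ℕ → Set
Symbol k n = Fin k ⊎ Fin n

record WordEquation (k n : ℕ) : Set where
  constructor _≐_
  field
    lhs : List (Symbol k n)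
    rhs : List (Symbol k n)
open WordEquation public

occ : ∀ {k n} → Fin n → List (Symbol k n) → ℕ
occ x [] = 0
occ x (inj₁ a ∷ w) = occ x w
occ x (inj₂ y ∷ w) with x ≟ y
... | yes _ = suc (occ x w)
... | no  _ = occ x w

Quadratic : ∀ {k n} → WordEquation k n → Set
Quadratic {n = n} E = (x : Fin n) → occ x (lhs E ++ rhs E) ≤ 2

Assignment : ℕ → ℕ → Set
Assignment k n = Fin n → List (Fin k)

subst : ∀ {k n} → Assignment k n → List (Symbol k n) → List (Fin k)
subst σ [] = []
subst σ (inj₁ a ∷ w) = a ∷ subst σ w
subst σ (inj₂ x ∷ w) = σ x ++ subst σ w

IsSolution : ∀ {k n} → WordEquation k n → Assignment k n → Set
IsSolution E σ = subst σ (lhs E) ≡ subst σ (rhs E)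

Len : ∀ {k n} → WordEquation k n → (Fin n → ℕ) → Set
Len {n = n} E v = Σ (Assignment _ n) λ σ → IsSolution E σ × ((x : Fin n) → length (σ x) ≡ v x)

-- Complete basis {=, ≤, ¬, ∧, ∀};
-- ∨, →, ∃ are the usual abbreviations.  With this basis the Set-valued
-- semantics below is ¬¬-stable, i.e. it coincides with classical truth
-- (a negative-translation style semantics).

data Term (m : ℕ) : Set where
  var  : Fin m → Term m
  `0   : Term m
  `1   : Term m
  _`+_ : Term m → Term m → Term m

data Formula (m : ℕ) : Set where
  _`=_  : Term m → Term m → Formula m
  _`≤_  : Term m → Term m → Formula m
  `¬_   : Formula m → Formula m
  _`∧_  : Formula m → Formula m → Formula m
  `∀_   : Formula (suc m) → Formula m

_∷ᵉ_ : ∀ {m} → ℕ → (Fin m → ℕ) → (Fin (suc m) → ℕ)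
(a ∷ᵉ ρ) zero = a
(a ∷ᵉ ρ) (suc i) = ρ i

⟦_⟧ᵗ : ∀ {m} → Term m → (Fin m → ℕ) → ℕ
⟦ var i ⟧ᵗ ρ = ρ i
⟦ `0 ⟧ᵗ ρ = 0
⟦ `1 ⟧ᵗ ρ = 1
⟦ s `+ t ⟧ᵗ ρ = ⟦ s ⟧ᵗ ρ + ⟦ t ⟧ᵗ ρ

⟦_⟧ : ∀ {m} → Formula m → (Fin m → ℕ) → Set
⟦ s `= t ⟧ ρ = ⟦ s ⟧ᵗ ρ ≡ ⟦ t ⟧ᵗ ρ
⟦ s `≤ t ⟧ ρ = ⟦ s ⟧ᵗ ρ ≤ ⟦ t ⟧ᵗ ρ
⟦ `¬ φ ⟧ ρ = ¬ ⟦ φ ⟧ ρ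
⟦ φ `∧ ψ ⟧ ρ = ⟦ φ ⟧ ρ × ⟦ ψ ⟧ ρ
⟦ `∀ φ ⟧ ρ = (a : ℕ) → ⟦ φ ⟧ (a ∷ᵉ ρ)

PresburgerDefinable : ∀ {m} → ((Fin m → ℕ) → Set) → Set
PresburgerDefinable {m} S =
  Σ (Formula m) λ φ → (v : Fin m → ℕ) → (S v → ⟦ φ ⟧ v) × (⟦ φ ⟧ v → S v)

-- There is a quadratic word equation whose length abstraction is not
-- Presburger-definable:  E :  x a b y = y a b x  over the alphabet {a, b}.
--
-- In a solution, x a b and y a b commute, so by Lyndon–Schützenberger
-- they are powers of one word t; t ends with a b, so |t| ≥ 2 divides both
-- |x| + 2 and |y| + 2.  Hence if |y| + 2 is prime there is no solution with
-- |x| < |y|, whereas x = a^m, y = (a^m a b)^P a^m is a solution for all m, P.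
--
-- Cooper's quantifier elimination turns every Presburger formula
-- into an equivalent quantifier-free one over linear inequalities and
-- divisibility literals, so every definable subset of ℕ is ultimately periodic.
-- If Len(E) were definable, so would be the set of y with no n < y such that
-- (n, y) ∈ Len(E).  It contains every m with m + 2 prime but no m + (m+2)·P;
-- as such m are unbounded (Euclid), this contradicts periodicity with period P.
module Submission where

open import Defs
open import Data.Nat as ℕ using (ℕ; zero; suc; z≤n; s≤s; _!)
import Data.Nat.Properties as ℕP
open import Data.Integer as ℤ using (ℤ; +_; -[1+_]; _+_; _-_; _*_; _≤_; +≤+; -1ℤ)
import Data.Integer.Properties as ℤP
open import Data.Integer.Divisibility.Signed
  using (_∣_; _∣?_; divides; ∣ᵤ⇒∣; ∣m∣n⇒∣m+n; ∣m+n∣n⇒∣m; ∣n⇒∣m*n; *-monoʳ-∣; *-cancelˡ-∣)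
import Data.Nat.Divisibility as ℕD
open import Data.Nat.Primality using (Prime; ¬prime[0]; ¬prime[1]; composite⇒¬prime)
open import Data.Nat.Divisibility.Core using (hasNonTrivialDivisor)
open import Data.Nat.Primality.Factorisation using (factorise)
open import Data.Nat.ListAction using (product)
open import Data.Nat.Induction using (<-rec)
open import Data.Integer.Tactic.RingSolver using (solve-∀)
import Data.Nat.Tactic.RingSolver as ℕR
open import Data.Fin using (Fin; zero; suc)
open import Data.Product using (Σ; _×_; _,_; proj₁; proj₂)
open import Data.Product.Function.NonDependent.Propositional using (_×-⇔_)
open import Data.Sum using (_⊎_; inj₁; inj₂)
open import Data.Sum.Function.Propositional using (_⊎-⇔_)
open import Data.List using (List; []; _∷_; [_]; _++_; length; replicate; upTo)
import Data.List.Properties as LP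
open import Data.List.Relation.Unary.All using (All; []; _∷_; all?)
open import Data.List.Relation.Unary.All.Properties using (++⁻; ++⁻ʳ; ¬All⇒Any¬)
open import Data.List.Relation.Unary.Any using (Any; here; there; satisfied)
open import Data.List.Membership.Propositional using (_∈_; lose; find)
open import Data.List.Membership.Propositional.Properties using (∈-upTo⁺)
open import Data.Unit using (⊤; tt)
open import Data.Empty using (⊥; ⊥-elim)
open import Function.Bundles using (_⇔_; mk⇔; Equivalence)
open import Function.Construct.Identity using (⇔-id)
open import Function.Construct.Symmetry using (⇔-sym)
open import Function.Properties.Equivalence using () renaming (trans to ⇔-trans)
open import Relation.Nullary using (¬_; Dec; yes; no)
open import Relation.Nullary.Decidable using (_×-dec_; _⊎-dec_; _→-dec_; ¬?; decidable-stable)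
import Relation.Nullary.Decidable as Decidable
open import Relation.Binary.PropositionalEquality as ≡ using (_≡_; refl; sym; trans; cong; cong₂)

open Equivalence using (to; from)

private variable
  m : ℕ
  A B : Set

Env : ℕ → Set
Env m = Fin m → ℕ

tailᵉ : Env (suc m) → Env m
tailᵉ ρ i = ρ (suc i)

-- Propositional laws of negation; those moving ¬ inward need decidability.
¬-⇔ : A ⇔ B → (¬ A) ⇔ (¬ B)
¬-⇔ A⇔B = mk⇔ (λ ¬a b → ¬a (from A⇔B b)) (λ ¬b a → ¬b (to A⇔B a))

¬×⇔¬⊎¬ : Dec A → (¬ (A × B)) ⇔ (¬ A ⊎ ¬ B)
¬×⇔¬⊎¬ {A} {B} a? = mk⇔ (split a?) λ { (inj₁ ¬a) (a , _) → ¬a a ; (inj₂ ¬b) (_ , b) → ¬b b }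
  where
  split : Dec A → ¬ (A × B) → ¬ A ⊎ ¬ B
  split (yes a) ¬ab = inj₂ λ b → ¬ab (a , b)
  split (no ¬a) _   = inj₁ ¬a

¬⊎⇔¬×¬ : (¬ (A ⊎ B)) ⇔ (¬ A × ¬ B)
¬⊎⇔¬×¬ = mk⇔ (λ h → (λ a → h (inj₁ a)) , (λ b → h (inj₂ b)))
              (λ { (¬a , ¬b) (inj₁ a) → ¬a a ; (¬a , ¬b) (inj₂ b) → ¬b b })

¬→⇒×¬ : Dec A → ¬ (A → B) → A × ¬ B
¬→⇒×¬ (yes a) ¬a→b = a , λ b → ¬a→b λ _ → b
¬→⇒×¬ (no ¬a) ¬a→b = ⊥-elim (¬a→b λ a → ⊥-elim (¬a a))

-- Linear forms  c₀ x₀ + … + c_{m-1} x_{m-1} + k  over ℤ, as coefficient lists.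
infixr 5 _∷ˡ_
data Lin : ℕ → Set where
  con  : ℤ → Lin 0
  _∷ˡ_ : ℤ → Lin m → Lin (suc m)

⟦_⟧ˡ : Lin m → Env m → ℤ
⟦ con k ⟧ˡ ρ = k
⟦ c ∷ˡ t ⟧ˡ ρ = c * + ρ zero + ⟦ t ⟧ˡ (tailᵉ ρ)

constˡ : ∀ m → ℤ → Lin m
constˡ zero k = con k
constˡ (suc m) k = + 0 ∷ˡ constˡ m k

⟦constˡ⟧ : ∀ m k (ρ : Env m) → ⟦ constˡ m k ⟧ˡ ρ ≡ k
⟦constˡ⟧ zero k ρ = refl
⟦constˡ⟧ (suc m) k ρ = trans (ℤP.+-identityˡ _) (⟦constˡ⟧ m k (tailᵉ ρ))

varˡ : Fin m → Lin m
varˡ {suc m} zero = + 1 ∷ˡ constˡ m (+ 0)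
varˡ {suc m} (suc i) = + 0 ∷ˡ varˡ i

⟦varˡ⟧ : ∀ (i : Fin m) ρ → ⟦ varˡ i ⟧ˡ ρ ≡ + ρ i
⟦varˡ⟧ {suc m} zero ρ = begin
  + 1 * + ρ zero + ⟦ constˡ m (+ 0) ⟧ˡ (tailᵉ ρ) ≡⟨ cong₂ _+_ (ℤP.*-identityˡ (+ ρ zero)) (⟦constˡ⟧ m (+ 0) (tailᵉ ρ)) ⟩
  + ρ zero + + 0                                  ≡⟨ ℤP.+-identityʳ (+ ρ zero) ⟩
  + ρ zero                                        ∎
  where open ≡.≡-Reasoning
⟦varˡ⟧ {suc m} (suc i) ρ = trans (ℤP.+-identityˡ _) (⟦varˡ⟧ i (tailᵉ ρ))

infixl 6 _+ˡ_ _-ˡ_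
infixl 7 _·ˡ_

_+ˡ_ : Lin m → Lin m → Lin m
con a +ˡ con b = con (a + b)
(c ∷ˡ s) +ˡ (d ∷ˡ t) = (c + d) ∷ˡ (s +ˡ t)

⟦+ˡ⟧ : ∀ (s t : Lin m) ρ → ⟦ s +ˡ t ⟧ˡ ρ ≡ ⟦ s ⟧ˡ ρ + ⟦ t ⟧ˡ ρ
⟦+ˡ⟧ (con a) (con b) ρ = refl
⟦+ˡ⟧ (c ∷ˡ s) (d ∷ˡ t) ρ =
  trans (cong (_+_ ((c + d) * + ρ zero)) (⟦+ˡ⟧ s t (tailᵉ ρ))) (regroup c d _ _ _)
  where
  regroup : ∀ c d x S T → (c + d) * x + (S + T) ≡ (c * x + S) + (d * x + T)
  regroup = solve-∀

_·ˡ_ : ℤ → Lin m → Lin m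
a ·ˡ con k = con (a * k)
a ·ˡ (c ∷ˡ t) = (a * c) ∷ˡ (a ·ˡ t)

⟦·ˡ⟧ : ∀ a (t : Lin m) ρ → ⟦ a ·ˡ t ⟧ˡ ρ ≡ a * ⟦ t ⟧ˡ ρ
⟦·ˡ⟧ a (con k) ρ = refl
⟦·ˡ⟧ a (c ∷ˡ t) ρ = trans (cong (_+_ (a * c * + ρ zero)) (⟦·ˡ⟧ a t (tailᵉ ρ))) (distrib a c _ _)
  where
  distrib : ∀ a c x T → a * c * x + a * T ≡ a * (c * x + T)
  distrib = solve-∀

_-ˡ_ : Lin m → Lin m → Lin m
s -ˡ t = s +ˡ -1ℤ ·ˡ t

⟦-ˡ⟧ : ∀ (s t : Lin m) ρ → ⟦ s -ˡ t ⟧ˡ ρ ≡ ⟦ s ⟧ˡ ρ - ⟦ t ⟧ˡ ρ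
⟦-ˡ⟧ s t ρ = trans (⟦+ˡ⟧ s (-1ℤ ·ˡ t) ρ) (cong (_+_ (⟦ s ⟧ˡ ρ)) (trans (⟦·ˡ⟧ -1ℤ t ρ) (ℤP.-1*i≡-i _)))

-- Quantifier-free formulas of Presburger arithmetic with divisibility
-- literals; the modulus of  dvd d t  is  d + 1.
data QF (m : ℕ) : Set where
  true false : QF m
  nonneg     : Lin m → QF m
  dvd ndvd   : ℕ → Lin m → QF m
  _∧ᵠ_ _∨ᵠ_  : QF m → QF m → QF m

⟦_⟧ᵠ : QF m → Env m → Set
⟦ true ⟧ᵠ ρ = ⊤
⟦ false ⟧ᵠ ρ = ⊥
⟦ nonneg t ⟧ᵠ ρ = + 0 ≤ ⟦ t ⟧ˡ ρ
⟦ dvd d t ⟧ᵠ ρ = + suc d ∣ ⟦ t ⟧ˡ ρ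
⟦ ndvd d t ⟧ᵠ ρ = ¬ (+ suc d ∣ ⟦ t ⟧ˡ ρ)
⟦ φ ∧ᵠ ψ ⟧ᵠ ρ = ⟦ φ ⟧ᵠ ρ × ⟦ ψ ⟧ᵠ ρ
⟦ φ ∨ᵠ ψ ⟧ᵠ ρ = ⟦ φ ⟧ᵠ ρ ⊎ ⟦ ψ ⟧ᵠ ρ

decᵠ : (ψ : QF m) (ρ : Env m) → Dec (⟦ ψ ⟧ᵠ ρ)
decᵠ true ρ = yes tt
decᵠ false ρ = no λ ()
decᵠ (nonneg t) ρ = + 0 ℤ.≤? ⟦ t ⟧ˡ ρ
decᵠ (dvd d t) ρ = + suc d ∣? ⟦ t ⟧ˡ ρ
decᵠ (ndvd d t) ρ = ¬? (+ suc d ∣? ⟦ t ⟧ˡ ρ)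
decᵠ (φ ∧ᵠ ψ) ρ = decᵠ φ ρ ×-dec decᵠ ψ ρ
decᵠ (φ ∨ᵠ ψ) ρ = decᵠ φ ρ ⊎-dec decᵠ ψ ρ

-- Over ℤ,  U < 0  iff  -1 - U ≥ 0; this lets negation stay inside QF.
nonneg-complement : ∀ U → (+ 0 ≤ -1ℤ - U) ⇔ (¬ (+ 0 ≤ U))
nonneg-complement (+ zero) = mk⇔ (λ ()) λ h → ⊥-elim (h (+≤+ z≤n))
nonneg-complement (+ suc k) = mk⇔ (λ ()) λ h → ⊥-elim (h (+≤+ z≤n))
nonneg-complement -[1+ k ] = mk⇔ (λ _ ()) (λ _ → +≤+ z≤n)

negᵠ : QF m → QF m
negᵠ true = false
negᵠ false = true
negᵠ {m} (nonneg t) = nonneg (constˡ m -1ℤ -ˡ t)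
negᵠ (dvd d t) = ndvd d t
negᵠ (ndvd d t) = dvd d t
negᵠ (φ ∧ᵠ ψ) = negᵠ φ ∨ᵠ negᵠ ψ
negᵠ (φ ∨ᵠ ψ) = negᵠ φ ∧ᵠ negᵠ ψ

negᵠ-correct : (ψ : QF m) (ρ : Env m) → ⟦ negᵠ ψ ⟧ᵠ ρ ⇔ (¬ ⟦ ψ ⟧ᵠ ρ)
negᵠ-correct true ρ = mk⇔ (λ ()) (λ h → h tt)
negᵠ-correct false ρ = mk⇔ (λ _ ()) (λ _ → tt)
negᵠ-correct {m} (nonneg t) ρ
  rewrite ⟦-ˡ⟧ (constˡ m -1ℤ) t ρ | ⟦constˡ⟧ m -1ℤ ρ = nonneg-complement (⟦ t ⟧ˡ ρ)
negᵠ-correct (dvd d t) ρ = mk⇔ (λ h → h) (λ h → h)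
negᵠ-correct (ndvd d t) ρ = mk⇔ (λ p ¬p → ¬p p) (decidable-stable (+ suc d ∣? ⟦ t ⟧ˡ ρ))
negᵠ-correct (φ ∧ᵠ ψ) ρ =
  ⇔-trans (negᵠ-correct φ ρ ⊎-⇔ negᵠ-correct ψ ρ) (⇔-sym (¬×⇔¬⊎¬ (decᵠ φ ρ)))
negᵠ-correct (φ ∨ᵠ ψ) ρ =
  ⇔-trans (negᵠ-correct φ ρ ×-⇔ negᵠ-correct ψ ρ) (⇔-sym ¬⊎⇔¬×¬)

⋁ : List A → (A → QF m) → QF m
⋁ [] g = false
⋁ (a ∷ as) g = g a ∨ᵠ ⋁ as g

⋁-correct : (as : List A) (g : A → QF m) (ρ : Env m) → ⟦ ⋁ as g ⟧ᵠ ρ ⇔ Any (λ a → ⟦ g a ⟧ᵠ ρ) as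
⋁-correct [] g ρ = mk⇔ (λ ()) (λ ())
⋁-correct (a ∷ as) g ρ = mk⇔
  (λ { (inj₁ h) → here h ; (inj₂ h) → there (to (⋁-correct as g ρ) h) })
  (λ { (here h) → inj₁ h ; (there h) → inj₂ (from (⋁-correct as g ρ) h) })

modulus : QF m → ℕ
modulus true = 1
modulus false = 1
modulus (nonneg _) = 1
modulus (dvd d _) = suc d
modulus (ndvd d _) = suc d
modulus (φ ∧ᵠ ψ) = modulus φ ℕ.* modulus ψ
modulus (φ ∨ᵠ ψ) = modulus φ ℕ.* modulus ψ

-- The modulus is positive, so it can serve as a period.
modulus-pos : (ψ : QF m) → 0 ℕ.< modulus ψ
modulus-pos true = s≤s z≤n
modulus-pos false = s≤s z≤n
modulus-pos (nonneg _) = s≤s z≤n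
modulus-pos (dvd d _) = s≤s z≤n
modulus-pos (ndvd d _) = s≤s z≤n
modulus-pos (φ ∧ᵠ ψ) = ℕP.*-mono-< (modulus-pos φ) (modulus-pos ψ)
modulus-pos (φ ∨ᵠ ψ) = ℕP.*-mono-< (modulus-pos φ) (modulus-pos ψ)

ModuliDivide : ℕ → QF m → Set
ModuliDivide D (dvd d _) = suc d ℕD.∣ D
ModuliDivide D (ndvd d _) = suc d ℕD.∣ D
ModuliDivide D (φ ∧ᵠ ψ) = ModuliDivide D φ × ModuliDivide D ψ
ModuliDivide D (φ ∨ᵠ ψ) = ModuliDivide D φ × ModuliDivide D ψ
ModuliDivide D _ = ⊤

moduliDivide-∣ : ∀ {D D′} (ψ : QF m) → ModuliDivide D ψ → D ℕD.∣ D′ → ModuliDivide D′ ψ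
moduliDivide-∣ true _ _ = tt
moduliDivide-∣ false _ _ = tt
moduliDivide-∣ (nonneg _) _ _ = tt
moduliDivide-∣ (dvd d _) d∣D D∣D′ = ℕD.∣-trans d∣D D∣D′
moduliDivide-∣ (ndvd d _) d∣D D∣D′ = ℕD.∣-trans d∣D D∣D′
moduliDivide-∣ (φ ∧ᵠ ψ) (hφ , hψ) D∣D′ = moduliDivide-∣ φ hφ D∣D′ , moduliDivide-∣ ψ hψ D∣D′
moduliDivide-∣ (φ ∨ᵠ ψ) (hφ , hψ) D∣D′ = moduliDivide-∣ φ hφ D∣D′ , moduliDivide-∣ ψ hψ D∣D′

moduliDivide-* : ∀ {a b} (φ ψ : QF m) → ModuliDivide a φ → ModuliDivide b ψ →
                 ModuliDivide (a ℕ.* b) φ × ModuliDivide (a ℕ.* b) ψ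
moduliDivide-* {a = a} {b} φ ψ hφ hψ = moduliDivide-∣ φ hφ (ℕD.m∣m*n b) , moduliDivide-∣ ψ hψ (ℕD.n∣m*n a)

moduliDivide-modulus : (ψ : QF m) → ModuliDivide (modulus ψ) ψ
moduliDivide-modulus true = tt
moduliDivide-modulus false = tt
moduliDivide-modulus (nonneg _) = tt
moduliDivide-modulus (dvd d _) = ℕD.∣-refl
moduliDivide-modulus (ndvd d _) = ℕD.∣-refl
moduliDivide-modulus (φ ∧ᵠ ψ) = moduliDivide-* φ ψ (moduliDivide-modulus φ) (moduliDivide-modulus ψ)
moduliDivide-modulus (φ ∨ᵠ ψ) = moduliDivide-* φ ψ (moduliDivide-modulus φ) (moduliDivide-modulus ψ)

dvd-shift : ∀ d D c x R → suc d ℕD.∣ D → (+ suc d ∣ c * + (x ℕ.+ D) + R) ⇔ (+ suc d ∣ c * + x + R)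
dvd-shift d D c x R d∣D = mk⇔
  (λ h → ∣m+n∣n⇒∣m (≡.subst (+ suc d ∣_) (shift c (+ x) (+ D) R) h) d∣cD)
  (λ h → ≡.subst (+ suc d ∣_) (sym (shift c (+ x) (+ D) R)) (∣m∣n⇒∣m+n h d∣cD))
  where
  d∣cD : + suc d ∣ c * + D
  d∣cD = ∣n⇒∣m*n c (∣ᵤ⇒∣ d∣D)
  shift : ∀ c X Y R → c * (X + Y) + R ≡ (c * X + R) + c * Y
  shift = solve-∀

-- Elimination of one existential quantifier (Cooper's method).

Bound : ℕ → Set
Bound m = ℕ × Lin m

⟦_⟧ᵇ : Bound m → ℕ → Env m → Set
⟦ n , r ⟧ᵇ x ρ = + 0 ≤ + suc n * + x + ⟦ r ⟧ˡ ρ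

lowerBounds : QF (suc m) → List (Bound m)
lowerBounds (nonneg (+ suc n ∷ˡ r)) = (n , r) ∷ []
lowerBounds (φ ∧ᵠ ψ) = lowerBounds φ ++ lowerBounds ψ
lowerBounds (φ ∨ᵠ ψ) = lowerBounds φ ++ lowerBounds ψ
lowerBounds _ = []

upperBound-descends : ∀ n x D R → + 0 ≤ -[1+ n ] * + (x ℕ.+ D) + R → + 0 ≤ -[1+ n ] * + x + R
upperBound-descends n x D R h =
  ℤP.≤-trans h (ℤP.+-monoˡ-≤ R (ℤP.*-monoˡ-≤-nonPos -[1+ n ] (+≤+ (ℕP.m≤m+n x D))))

-- The key step of Cooper's method: if D is a common multiple of the moduli and
-- no lower bound is violated by stepping from x + D down to x, then ψ(x + D)
-- implies ψ(x): upper bounds only get easier, divisibility literals are D-periodic.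
descend : (ψ : QF (suc m)) (ρ : Env m) (x D : ℕ) → ModuliDivide D ψ →
          All (λ b → ⟦ b ⟧ᵇ (x ℕ.+ D) ρ → ⟦ b ⟧ᵇ x ρ) (lowerBounds ψ) →
          ⟦ ψ ⟧ᵠ ((x ℕ.+ D) ∷ᵉ ρ) → ⟦ ψ ⟧ᵠ (x ∷ᵉ ρ)
descend true ρ x D _ _ h = h
descend (nonneg (+ zero ∷ˡ r)) ρ x D _ _ h = h
descend (nonneg (+ suc n ∷ˡ r)) ρ x D _ (kept ∷ []) h = kept h
descend (nonneg (-[1+ n ] ∷ˡ r)) ρ x D _ _ h = upperBound-descends n x D (⟦ r ⟧ˡ ρ) h
descend (dvd d (c ∷ˡ r)) ρ x D d∣D _ h = to (dvd-shift d D c x (⟦ r ⟧ˡ ρ) d∣D) h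
descend (ndvd d (c ∷ˡ r)) ρ x D d∣D _ h = ¬-⇔ (dvd-shift d D c x (⟦ r ⟧ˡ ρ) d∣D) .to h
descend (φ ∧ᵠ ψ) ρ x D (dφ , dψ) kept (hφ , hψ) =
  descend φ ρ x D dφ (proj₁ (++⁻ (lowerBounds φ) kept)) hφ , descend ψ ρ x D dψ (proj₂ (++⁻ (lowerBounds φ) kept)) hψ
descend (φ ∨ᵠ ψ) ρ x D (dφ , dψ) kept (inj₁ hφ) = inj₁ (descend φ ρ x D dφ (proj₁ (++⁻ (lowerBounds φ) kept)) hφ)
descend (φ ∨ᵠ ψ) ρ x D (dφ , dψ) kept (inj₂ hψ) = inj₂ (descend ψ ρ x D dψ (proj₂ (++⁻ (lowerBounds φ) kept)) hψ)

nonneg-scale : ∀ n U → (+ 0 ≤ U) ⇔ (+ 0 ≤ + suc n * U)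
nonneg-scale n U = mk⇔ scale cancel
  where
  scale : ∀ {U} → + 0 ≤ U → + 0 ≤ + suc n * U
  scale {+ k} _ = ≡.subst (+ 0 ≤_) (ℤP.pos-* (suc n) k) (+≤+ z≤n)
  cancel : ∀ {U} → + 0 ≤ + suc n * U → + 0 ≤ U
  cancel {+ k} _ = +≤+ z≤n
  cancel { -[1+ k ]} ()

dvd-scale : ∀ n k U → (k ∣ U) ⇔ (+ suc n * k ∣ + suc n * U)
dvd-scale n k U = mk⇔ (*-monoʳ-∣ (+ suc n)) (*-cancelˡ-∣ (+ suc n))

-- ψ[(n+1)·x := e]: every literal  c·x + r  is multiplied by n + 1, then
-- (n+1)·x is replaced by e (moduli are multiplied by n + 1 as well).
substitute : ℕ → Lin m → QF (suc m) → QF m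
substitute n e true = true
substitute n e false = false
substitute n e (nonneg (c ∷ˡ r)) = nonneg (c ·ˡ e +ˡ + suc n ·ˡ r)
substitute n e (dvd d (c ∷ˡ r)) = dvd (d ℕ.+ n ℕ.* suc d) (c ·ˡ e +ˡ + suc n ·ˡ r)
substitute n e (ndvd d (c ∷ˡ r)) = ndvd (d ℕ.+ n ℕ.* suc d) (c ·ˡ e +ˡ + suc n ·ˡ r)
substitute n e (φ ∧ᵠ ψ) = substitute n e φ ∧ᵠ substitute n e ψ
substitute n e (φ ∨ᵠ ψ) = substitute n e φ ∨ᵠ substitute n e ψ

⟦substituted⟧ : ∀ n (e : Lin m) c r x ρ → + suc n * + x ≡ ⟦ e ⟧ˡ ρ →
                ⟦ c ·ˡ e +ˡ + suc n ·ˡ r ⟧ˡ ρ ≡ + suc n * (c * + x + ⟦ r ⟧ˡ ρ)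
⟦substituted⟧ n e c r x ρ root = begin
  ⟦ c ·ˡ e +ˡ + suc n ·ˡ r ⟧ˡ ρ              ≡⟨ ⟦+ˡ⟧ (c ·ˡ e) (+ suc n ·ˡ r) ρ ⟩
  ⟦ c ·ˡ e ⟧ˡ ρ + ⟦ + suc n ·ˡ r ⟧ˡ ρ         ≡⟨ cong₂ _+_ (⟦·ˡ⟧ c e ρ) (⟦·ˡ⟧ (+ suc n) r ρ) ⟩
  c * ⟦ e ⟧ˡ ρ + + suc n * ⟦ r ⟧ˡ ρ           ≡⟨ cong (λ E → c * E + + suc n * ⟦ r ⟧ˡ ρ) (sym root) ⟩
  c * (+ suc n * + x) + + suc n * ⟦ r ⟧ˡ ρ    ≡⟨ factor c (+ suc n) (+ x) (⟦ r ⟧ˡ ρ) ⟩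
  + suc n * (c * + x + ⟦ r ⟧ˡ ρ)              ∎
  where
  open ≡.≡-Reasoning
  factor : ∀ c s X R → c * (s * X) + s * R ≡ s * (c * X + R)
  factor = solve-∀

substitute-correct : (ψ : QF (suc m)) (n : ℕ) (e : Lin m) (x : ℕ) (ρ : Env m) → + suc n * + x ≡ ⟦ e ⟧ˡ ρ →
                     ⟦ ψ ⟧ᵠ (x ∷ᵉ ρ) ⇔ ⟦ substitute n e ψ ⟧ᵠ ρ
substitute-correct true n e x ρ root = ⇔-id _
substitute-correct false n e x ρ root = ⇔-id _
substitute-correct (nonneg (c ∷ˡ r)) n e x ρ root
  rewrite ⟦substituted⟧ n e c r x ρ root = nonneg-scale n _
substitute-correct (dvd d (c ∷ˡ r)) n e x ρ root
  rewrite ⟦substituted⟧ n e c r x ρ root = dvd-scale n (+ suc d) _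
substitute-correct (ndvd d (c ∷ˡ r)) n e x ρ root
  rewrite ⟦substituted⟧ n e c r x ρ root = ¬-⇔ (dvd-scale n (+ suc d) _)
substitute-correct (φ ∧ᵠ ψ) n e x ρ root = substitute-correct φ n e x ρ root ×-⇔ substitute-correct ψ n e x ρ root
substitute-correct (φ ∨ᵠ ψ) n e x ρ root = substitute-correct φ n e x ρ root ⊎-⇔ substitute-correct ψ n e x ρ root

natural-quotient : ∀ n E → + suc n ∣ E → + 0 ≤ E → Σ ℕ λ x → + suc n * + x ≡ E
natural-quotient n E (divides (+ x) eq) _ = x , trans (ℤP.*-comm (+ suc n) (+ x)) (sym eq)
natural-quotient n E (divides -[1+ k ] refl) ()

hasRoot : QF (suc m) → ℕ → Lin m → QF m
hasRoot ψ n e = dvd n e ∧ᵠ (nonneg e ∧ᵠ substitute n e ψ)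

hasRoot-correct : ∀ (ψ : QF (suc m)) n e ρ →
                  ⟦ hasRoot ψ n e ⟧ᵠ ρ ⇔ (Σ ℕ λ x → (+ suc n * + x ≡ ⟦ e ⟧ˡ ρ) × ⟦ ψ ⟧ᵠ (x ∷ᵉ ρ))
hasRoot-correct ψ n e ρ = mk⇔
  (λ (n∣e , 0≤e , ψ[e]) → let (x , root) = natural-quotient n _ n∣e 0≤e in
                          x , root , from (substitute-correct ψ n e x ρ root) ψ[e])
  (λ (x , root , ψx) → divides (+ x) (trans (sym root) (ℤP.*-comm (+ suc n) (+ x)))
                     , ≡.subst (+ 0 ≤_) root (to (nonneg-scale n (+ x)) (+≤+ z≤n))
                     , to (substitute-correct ψ n e x ρ root) ψx)

-- The test points: the bound 1·x + 0 ≥ 0 together with all lower bounds of ψ.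
testPoints : QF (suc m) → List (Bound m)
testPoints {m} ψ = (0 , constˡ m (+ 0)) ∷ lowerBounds ψ

searchFrom : QF (suc m) → Bound m → QF m
searchFrom {m} ψ (n , r) = ⋁ (upTo (suc n ℕ.* modulus ψ)) λ j → hasRoot ψ n (constˡ m (+ j) -ˡ r)

elim : QF (suc m) → QF m
elim ψ = ⋁ (testPoints ψ) (searchFrom ψ)

elim-sound : ∀ (ψ : QF (suc m)) ρ → ⟦ elim ψ ⟧ᵠ ρ → Σ ℕ λ x → ⟦ ψ ⟧ᵠ (x ∷ᵉ ρ)
elim-sound {m} ψ ρ h
  with (n , r) , h₁ ← satisfied (to (⋁-correct (testPoints ψ) (searchFrom ψ) ρ) h)
  with j , h₂ ← satisfied (to (⋁-correct (upTo _) (λ j → hasRoot ψ n (constˡ m (+ j) -ˡ r)) ρ) h₁)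
  with x , _ , ψx ← to (hasRoot-correct ψ n (constˡ m (+ j) -ˡ r) ρ) h₂ = x , ψx

elim-intro : ∀ (ψ : QF (suc m)) ρ {n r j} → (n , r) ∈ testPoints ψ → j ℕ.< suc n ℕ.* modulus ψ →
             ∀ x → + suc n * + x ≡ + j - ⟦ r ⟧ˡ ρ → ⟦ ψ ⟧ᵠ (x ∷ᵉ ρ) → ⟦ elim ψ ⟧ᵠ ρ
elim-intro {m} ψ ρ {n} {r} {j} b∈ j< x root ψx =
  from (⋁-correct (testPoints ψ) (searchFrom ψ) ρ) (lose b∈
    (from (⋁-correct (upTo _) (λ j → hasRoot ψ n (constˡ m (+ j) -ˡ r)) ρ) (lose (∈-upTo⁺ j<)
      (from (hasRoot-correct ψ n e ρ) (x , trans root (sym ⟦e⟧) , ψx)))))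
  where
  e = constˡ m (+ j) -ˡ r
  ⟦e⟧ : ⟦ e ⟧ˡ ρ ≡ + j - ⟦ r ⟧ˡ ρ
  ⟦e⟧ = trans (⟦-ˡ⟧ (constˡ m (+ j)) r ρ) (cong (_- ⟦ r ⟧ˡ ρ) (⟦constˡ⟧ m (+ j) ρ))

crossing : ∀ a b → a ℤ.< + 0 → + 0 ≤ a + + b → Σ ℕ λ j → (j ℕ.< b) × (+ j ≡ a + + b)
crossing a b a<0 0≤a+b = ℤ.∣ a + + b ∣ , ℤP.drop‿+<+ (≡.subst (ℤ._< + b) (sym a+b≡j) (ℤP.+-monoˡ-< (+ b) a<0)) , a+b≡j
  where
  a+b≡j : + ℤ.∣ a + + b ∣ ≡ a + + b
  a+b≡j = ℤP.0≤i⇒+∣i∣≡i 0≤a+b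

crossed-bound : ∀ n (r : Lin m) x D ρ → ⟦ n , r ⟧ᵇ (x ℕ.+ D) ρ → ¬ ⟦ n , r ⟧ᵇ x ρ →
                Σ ℕ λ j → (j ℕ.< suc n ℕ.* D) × (+ suc n * + (x ℕ.+ D) ≡ + j - ⟦ r ⟧ˡ ρ)
crossed-bound n r x D ρ above ¬below =
  finish (crossing a (suc n ℕ.* D) (ℤP.≰⇒> ¬below) (≡.subst (+ 0 ≤_) shifted above))
  where
  R = ⟦ r ⟧ˡ ρ
  a = + suc n * + x + R
  distrib : ∀ c X Y R → c * (X + Y) + R ≡ (c * X + R) + c * Y
  distrib = solve-∀
  shifted : + suc n * + (x ℕ.+ D) + R ≡ a + + (suc n ℕ.* D)
  shifted = trans (distrib (+ suc n) (+ x) (+ D) R) (cong (_+_ a) (sym (ℤP.pos-* (suc n) D)))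
  cancel : ∀ S R → S ≡ (S + R) - R
  cancel = solve-∀
  finish : (Σ ℕ λ j → (j ℕ.< suc n ℕ.* D) × (+ j ≡ a + + (suc n ℕ.* D))) →
           Σ ℕ λ j → (j ℕ.< suc n ℕ.* D) × (+ suc n * + (x ℕ.+ D) ≡ + j - R)
  finish (j , j< , j≡) = j , j< , trans (cancel _ R) (cong (_- R) (trans shifted (sym j≡)))

⟦_⟧ᵇ? : (b : Bound m) (x : ℕ) (ρ : Env m) → Dec (⟦ b ⟧ᵇ x ρ)
⟦ n , r ⟧ᵇ? x ρ = + 0 ℤ.≤? + suc n * + x + ⟦ r ⟧ˡ ρ

-- Completeness, by strong induction on a solution x: a solution below the
-- modulus D is found at the first test point; otherwise either every lower bound
-- survives the step from x to x - D (and ψ(x - D) holds by descend), or some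
-- lower bound is crossed, and x is found in the search range of that bound.
elim-complete : ∀ (ψ : QF (suc m)) ρ x → ⟦ ψ ⟧ᵠ (x ∷ᵉ ρ) → ⟦ elim ψ ⟧ᵠ ρ
elim-complete {m} ψ ρ = <-rec _ search
  where
  D = modulus ψ
  small : ∀ x → x ℕ.< D → ⟦ ψ ⟧ᵠ (x ∷ᵉ ρ) → ⟦ elim ψ ⟧ᵠ ρ
  small x x<D = elim-intro ψ ρ (here refl) (≡.subst (x ℕ.<_) (sym (ℕP.+-identityʳ D)) x<D) x root
    where
    root : + 1 * + x ≡ + x - ⟦ constˡ m (+ 0) ⟧ˡ ρ
    root = trans (ℤP.*-identityˡ (+ x)) (sym (trans (cong (_-_ (+ x)) (⟦constˡ⟧ m (+ 0) ρ)) (ℤP.+-identityʳ (+ x))))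
  kept? : ∀ x (b : Bound m) → Dec (⟦ b ⟧ᵇ (x ℕ.+ D) ρ → ⟦ b ⟧ᵇ x ρ)
  kept? x b = ⟦ b ⟧ᵇ? (x ℕ.+ D) ρ →-dec ⟦ b ⟧ᵇ? x ρ
  stepDown : ∀ x → (⟦ ψ ⟧ᵠ (x ∷ᵉ ρ) → ⟦ elim ψ ⟧ᵠ ρ) → ⟦ ψ ⟧ᵠ ((x ℕ.+ D) ∷ᵉ ρ) → ⟦ elim ψ ⟧ᵠ ρ
  stepDown x below ψx+D with all? (kept? x) (lowerBounds ψ)
  ... | yes kept = below (descend ψ ρ x D (moduliDivide-modulus ψ) kept ψx+D)
  ... | no ¬kept
    with (n , r) , b∈ , ¬keptᵇ ← find (¬All⇒Any¬ (kept? x) _ ¬kept)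
    with above , ¬below ← ¬→⇒×¬ (⟦ n , r ⟧ᵇ? (x ℕ.+ D) ρ) ¬keptᵇ
    with j , j< , root ← crossed-bound n r x D ρ above ¬below
    = elim-intro ψ ρ (there b∈) j< (x ℕ.+ D) root ψx+D
  search : ∀ x → (∀ {y} → y ℕ.< x → ⟦ ψ ⟧ᵠ (y ∷ᵉ ρ) → ⟦ elim ψ ⟧ᵠ ρ) → ⟦ ψ ⟧ᵠ (x ∷ᵉ ρ) → ⟦ elim ψ ⟧ᵠ ρ
  search x smaller ψx with x ℕ.<? D
  ... | yes x<D = small x x<D ψx
  ... | no x≮D = stepDown (x ℕ.∸ D) (smaller (ℕP.∸-monoʳ-< (modulus-pos ψ) D≤x))
                          (≡.subst (λ y → ⟦ ψ ⟧ᵠ (y ∷ᵉ ρ)) (sym (ℕP.m∸n+n≡m D≤x)) ψx)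
    where
    D≤x : D ℕ.≤ x
    D≤x = ℕP.≮⇒≥ x≮D

elim-correct : ∀ (ψ : QF (suc m)) ρ → ⟦ elim ψ ⟧ᵠ ρ ⇔ (Σ ℕ λ x → ⟦ ψ ⟧ᵠ (x ∷ᵉ ρ))
elim-correct ψ ρ = mk⇔ (elim-sound ψ ρ) λ (x , ψx) → elim-complete ψ ρ x ψx

termˡ : Term m → Lin m
termˡ (var i) = varˡ i
termˡ {m} `0 = constˡ m (+ 0)
termˡ {m} `1 = constˡ m (+ 1)
termˡ (s `+ t) = termˡ s +ˡ termˡ t

⟦termˡ⟧ : ∀ (t : Term m) ρ → ⟦ termˡ t ⟧ˡ ρ ≡ + ⟦ t ⟧ᵗ ρ
⟦termˡ⟧ (var i) ρ = ⟦varˡ⟧ i ρ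
⟦termˡ⟧ {m} `0 ρ = ⟦constˡ⟧ m (+ 0) ρ
⟦termˡ⟧ {m} `1 ρ = ⟦constˡ⟧ m (+ 1) ρ
⟦termˡ⟧ (s `+ t) ρ = trans (⟦+ˡ⟧ (termˡ s) (termˡ t) ρ) (cong₂ _+_ (⟦termˡ⟧ s ρ) (⟦termˡ⟧ t ρ))

leᵠ : Term m → Term m → QF m
leᵠ s t = nonneg (termˡ t -ˡ termˡ s)

leᵠ-correct : ∀ (s t : Term m) ρ → (⟦ s ⟧ᵗ ρ ℕ.≤ ⟦ t ⟧ᵗ ρ) ⇔ ⟦ leᵠ s t ⟧ᵠ ρ
leᵠ-correct s t ρ rewrite ⟦-ˡ⟧ (termˡ t) (termˡ s) ρ | ⟦termˡ⟧ s ρ | ⟦termˡ⟧ t ρ =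
  mk⇔ (λ s≤t → ℤP.i≤j⇒0≤j-i (+≤+ s≤t)) (λ 0≤t-s → ℤP.drop‿+≤+ (ℤP.0≤i-j⇒j≤i 0≤t-s))

qf : Formula m → QF m
qf (s `= t) = leᵠ s t ∧ᵠ leᵠ t s
qf (s `≤ t) = leᵠ s t
qf (`¬ φ) = negᵠ (qf φ)
qf (φ `∧ ψ) = qf φ ∧ᵠ qf ψ
qf (`∀ φ) = negᵠ (elim (negᵠ (qf φ)))

qf-correct : ∀ (φ : Formula m) ρ → ⟦ φ ⟧ ρ ⇔ ⟦ qf φ ⟧ᵠ ρ
qf-correct (s `= t) ρ = mk⇔
  (λ s≡t → to (leᵠ-correct s t ρ) (ℕP.≤-reflexive s≡t) , to (leᵠ-correct t s ρ) (ℕP.≤-reflexive (sym s≡t)))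
  (λ (s≤t , t≤s) → ℕP.≤-antisym (from (leᵠ-correct s t ρ) s≤t) (from (leᵠ-correct t s ρ) t≤s))
qf-correct (s `≤ t) ρ = leᵠ-correct s t ρ
qf-correct (`¬ φ) ρ = ⇔-trans (¬-⇔ (qf-correct φ ρ)) (⇔-sym (negᵠ-correct (qf φ) ρ))
qf-correct (φ `∧ ψ) ρ = qf-correct φ ρ ×-⇔ qf-correct ψ ρ
qf-correct (`∀ φ) ρ = mk⇔ forward backward
  where
  ψ = negᵠ (qf φ)
  ψ⇔¬φ : ∀ x → ⟦ ψ ⟧ᵠ (x ∷ᵉ ρ) ⇔ (¬ ⟦ φ ⟧ (x ∷ᵉ ρ))
  ψ⇔¬φ x = ⇔-trans (negᵠ-correct (qf φ) (x ∷ᵉ ρ)) (¬-⇔ (⇔-sym (qf-correct φ (x ∷ᵉ ρ))))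
  forward : ⟦ `∀ φ ⟧ ρ → ⟦ negᵠ (elim ψ) ⟧ᵠ ρ
  forward ∀φ = from (negᵠ-correct (elim ψ) ρ) λ ∃ψ →
    let (x , ψx) = to (elim-correct ψ ρ) ∃ψ in to (ψ⇔¬φ x) ψx (∀φ x)
  -- φ(x) is decidable, being equivalent to a quantifier-free formula
  backward : ⟦ negᵠ (elim ψ) ⟧ᵠ ρ → ⟦ `∀ φ ⟧ ρ
  backward ¬∃ψ x = decidable-stable (Decidable.map (⇔-sym (qf-correct φ (x ∷ᵉ ρ))) (decᵠ (qf φ) (x ∷ᵉ ρ))) λ ¬φx →
    to (negᵠ-correct (elim ψ) ρ) ¬∃ψ (from (elim-correct ψ ρ) (x , from (ψ⇔¬φ x) ¬φx))

-- Presburger-definable sets of natural numbers are ultimately periodic.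

Periodic : (ℕ → Set) → ℕ → ℕ → Set
Periodic S N P = ∀ x → N ℕ.≤ x → S x ⇔ S (x ℕ.+ P)

UltimatelyPeriodic : (ℕ → Set) → Set
UltimatelyPeriodic S = Σ ℕ λ N → Σ ℕ λ P → (0 ℕ.< P) × Periodic S N P

periodic-multiple : ∀ {S N P} → Periodic S N P → ∀ k x → N ℕ.≤ x → S x ⇔ S (x ℕ.+ k ℕ.* P)
periodic-multiple {S} periodic zero x N≤x = ≡.subst (λ y → S x ⇔ S y) (sym (ℕP.+-identityʳ x)) (⇔-id _)
periodic-multiple {S} {N} {P} periodic (suc k) x N≤x =
  ⇔-trans (periodic x N≤x)
          (≡.subst (λ y → S (x ℕ.+ P) ⇔ S y) (ℕP.+-assoc x P (k ℕ.* P))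
                   (periodic-multiple periodic k (x ℕ.+ P) (ℕP.≤-trans N≤x (ℕP.m≤m+n x P))))

⟨_⟩ : ℕ → Env 1
⟨ x ⟩ _ = x

eventually-nonneg : ∀ n k → Σ ℕ λ N → ∀ x → N ℕ.≤ x → + 0 ≤ + suc n * + x + k
eventually-nonneg n (+ k) = 0 , λ x _ → ≡.subst (λ y → + 0 ≤ y + + k) (ℤP.pos-* (suc n) x) (+≤+ z≤n)
eventually-nonneg n -[1+ k ] = suc k , λ x k<x →
  ≡.subst (λ y → + 0 ≤ y + -[1+ k ]) (ℤP.pos-* (suc n) x)
          (≡.subst (+ 0 ≤_) (sym (ℤP.⊖-≥ (ℕP.≤-trans k<x (ℕP.m≤n*m x (suc n))))) (+≤+ z≤n))

-- The truth value of  c·x + k ≥ 0  is eventually constant; a negative slope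
-- reduces to a positive one through  U < 0 ⇔ -1 - U ≥ 0.
nonneg-eventually-constant : ∀ c k → Σ ℕ λ N → ∀ x y → N ℕ.≤ x → N ℕ.≤ y →
                             (+ 0 ≤ c * + x + k) ⇔ (+ 0 ≤ c * + y + k)
nonneg-eventually-constant (+ zero) k = 0 , λ _ _ _ _ → ⇔-id _
nonneg-eventually-constant (+ suc n) k with N , pos ← eventually-nonneg n k =
  N , λ x y N≤x N≤y → mk⇔ (λ _ → pos y N≤y) (λ _ → pos x N≤x)
nonneg-eventually-constant -[1+ n ] k with N , pos ← eventually-nonneg n (-1ℤ - k) =
  N , λ x y N≤x N≤y → mk⇔ (λ h → ⊥-elim (neg x N≤x h)) (λ h → ⊥-elim (neg y N≤y h))
  where
  flip-sign : ∀ c X k → c * X + (-1ℤ - k) ≡ -1ℤ - (ℤ.- c * X + k)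
  flip-sign = solve-∀
  neg : ∀ x → N ℕ.≤ x → ¬ (+ 0 ≤ -[1+ n ] * + x + k)
  neg x N≤x = to (nonneg-complement _) (≡.subst (+ 0 ≤_) (flip-sign (+ suc n) (+ x) k) (pos x N≤x))

qf-periodic : (ψ : QF 1) (D : ℕ) → ModuliDivide D ψ → Σ ℕ λ N → Periodic (λ x → ⟦ ψ ⟧ᵠ ⟨ x ⟩) N D
qf-periodic true D _ = 0 , λ _ _ → ⇔-id _
qf-periodic false D _ = 0 , λ _ _ → ⇔-id _
qf-periodic (nonneg (c ∷ˡ con k)) D _ with N , constant ← nonneg-eventually-constant c k =
  N , λ x N≤x → constant x (x ℕ.+ D) N≤x (ℕP.≤-trans N≤x (ℕP.m≤m+n x D))
qf-periodic (dvd d (c ∷ˡ con k)) D d∣D = 0 , λ x _ → ⇔-sym (dvd-shift d D c x k d∣D)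
qf-periodic (ndvd d (c ∷ˡ con k)) D d∣D = 0 , λ x _ → ¬-⇔ (⇔-sym (dvd-shift d D c x k d∣D))
qf-periodic (φ ∧ᵠ ψ) D (dφ , dψ)
  with Nφ , pφ ← qf-periodic φ D dφ | Nψ , pψ ← qf-periodic ψ D dψ =
  Nφ ℕ.⊔ Nψ , λ x N≤x → pφ x (ℕP.m⊔n≤o⇒m≤o Nφ Nψ N≤x) ×-⇔ pψ x (ℕP.m⊔n≤o⇒n≤o Nφ Nψ N≤x)
qf-periodic (φ ∨ᵠ ψ) D (dφ , dψ)
  with Nφ , pφ ← qf-periodic φ D dφ | Nψ , pψ ← qf-periodic ψ D dψ =
  Nφ ℕ.⊔ Nψ , λ x N≤x → pφ x (ℕP.m⊔n≤o⇒m≤o Nφ Nψ N≤x) ⊎-⇔ pψ x (ℕP.m⊔n≤o⇒n≤o Nφ Nψ N≤x)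

presburger-periodic : (φ : Formula 1) → UltimatelyPeriodic (λ x → ⟦ φ ⟧ ⟨ x ⟩)
presburger-periodic φ with N , periodic ← qf-periodic (qf φ) (modulus (qf φ)) (moduliDivide-modulus (qf φ)) =
  N , modulus (qf φ) , modulus-pos (qf φ) ,
  λ x N≤x → ⇔-trans (qf-correct φ ⟨ x ⟩) (⇔-trans (periodic x N≤x) (⇔-sym (qf-correct φ _)))

-- There are arbitrarily large primes.

prime-divisor : ∀ n → 1 ℕ.< n → Σ ℕ λ p → Prime p × p ℕD.∣ n
prime-divisor (suc zero) (s≤s ())
prime-divisor (suc (suc n)) _ with factorise (suc (suc n))
... | record { factors = [] ; isFactorisation = () }
... | record { factors = p ∷ ps ; isFactorisation = n≡Πps ; factorsPrime = p-prime ∷ _ } =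
  p , p-prime , ℕD.divides (product ps) (trans n≡Πps (ℕP.*-comm p (product ps)))

∣-factorial : ∀ {k B} → suc k ℕ.≤ B → suc k ℕD.∣ B !
∣-factorial {k} k<B = ℕD.∣-trans (ℕD.m∣m*n (k !)) (ℕD.m≤n⇒m!∣n! k<B)

-- Euclid: a prime divisor of B! + 1 exceeds B.
prime-above : ∀ B → Σ ℕ λ p → Prime p × B ℕ.< p
prime-above B with prime-divisor (suc (B !)) (s≤s (ℕP.1≤n! B))
... | p , p-prime , p∣B!+1 with B ℕ.<? p
...   | yes B<p = p , p-prime , B<p
...   | no B≮p = ⊥-elim (¬prime[1] (≡.subst Prime (ℕD.∣1⇒≡1 p∣1) p-prime))
  where
  p∣1 : p ℕD.∣ 1
  p∣1 = ℕD.∣m+n∣m⇒∣n (≡.subst (p ℕD.∣_) (ℕP.+-comm 1 (B !)) p∣B!+1) (p∣B! p p-prime (ℕP.≮⇒≥ B≮p))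
    where
    p∣B! : ∀ p → Prime p → p ℕ.≤ B → p ℕD.∣ B !
    p∣B! zero 0-prime _ = ⊥-elim (¬prime[0] 0-prime)
    p∣B! (suc k) _ p≤B = ∣-factorial p≤B

prime-plus-two-above : ∀ B → Σ ℕ λ m → Prime (suc (suc m)) × B ℕ.≤ m
prime-plus-two-above B with prime-above (suc B)
... | suc (suc m) , p-prime , s≤s (s≤s B≤m) = m , p-prime , B≤m

-- Combinatorics on words: commuting words are powers of a common word.

infixr 8 _^ʷ_

_^ʷ_ : List A → ℕ → List A
t ^ʷ zero = []
t ^ʷ suc i = t ++ t ^ʷ i

^ʷ-+ : (t : List A) (i j : ℕ) → t ^ʷ i ++ t ^ʷ j ≡ t ^ʷ (i ℕ.+ j)
^ʷ-+ t zero j = refl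
^ʷ-+ t (suc i) j = trans (LP.++-assoc t (t ^ʷ i) (t ^ʷ j)) (cong (t ++_) (^ʷ-+ t i j))

^ʷ-comm : (t : List A) (i : ℕ) → t ^ʷ i ++ t ≡ t ++ t ^ʷ i
^ʷ-comm t zero = sym (LP.++-identityʳ t)
^ʷ-comm t (suc i) = trans (LP.++-assoc t (t ^ʷ i) t) (cong (t ++_) (^ʷ-comm t i))

length-^ʷ : (t : List A) (i : ℕ) → length (t ^ʷ i) ≡ i ℕ.* length t
length-^ʷ t zero = refl
length-^ʷ t (suc i) = trans (LP.length-++ t) (cong (length t ℕ.+_) (length-^ʷ t i))

^ʷ-letter : (c : A) (i : ℕ) → All (_≡ c) ([ c ] ^ʷ i)
^ʷ-letter c zero = []
^ʷ-letter c (suc i) = refl ∷ ^ʷ-letter c i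

prefix : (u v p q : List A) → u ++ p ≡ v ++ q → length u ℕ.≤ length v → Σ (List A) λ w → v ≡ u ++ w
prefix [] v p q eq _ = v , refl
prefix (c ∷ u) (d ∷ v) p q eq (s≤s u≤v) with refl , eq′ ← LP.∷-injective eq with w , refl ← prefix u v p q eq′ u≤v
  = w , refl

Powers : List A → List A → Set
Powers {A} u v = Σ (List A) λ t → Σ ℕ λ i → Σ ℕ λ j → (u ≡ t ^ʷ i) × (v ≡ t ^ʷ j)

powers-swap : {u v : List A} → Powers u v → Powers v u
powers-swap (t , i , j , u≡ , v≡) = t , j , i , v≡ , u≡

powers-extend : {u w : List A} → Powers u w → Powers u (u ++ w)
powers-extend (t , i , j , refl , refl) = t , i , i ℕ.+ j , refl , ^ʷ-+ t i j

shrink : ∀ a b n → suc a ℕ.+ (suc a ℕ.+ b) ℕ.≤ suc n → suc a ℕ.+ b ℕ.≤ n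
shrink a b n size = ℕP.≤-pred (ℕP.≤-trans (ℕP.+-monoˡ-≤ (suc a ℕ.+ b) (s≤s z≤n)) size)

-- Lyndon–Schützenberger, by induction on  n ≥ |u| + |v|: if |u| ≤ |v| then
-- v = u w, and u, w commute again and are shorter in total.
commuting-powers′ : ∀ n (u v : List A) → length u ℕ.+ length v ℕ.≤ n → u ++ v ≡ v ++ u → Powers u v
commuting-powers′ _ [] v _ _ = v , 0 , 1 , refl , sym (LP.++-identityʳ v)
commuting-powers′ _ u@(_ ∷ _) [] _ _ = u , 1 , 0 , sym (LP.++-identityʳ u) , refl
commuting-powers′ (suc n) u@(_ ∷ _) v@(_ ∷ _) size uv with length u ℕ.≤? length v
... | yes u≤v with w , refl ← prefix u v v u uv u≤v =
  powers-extend (commuting-powers′ n u w (shrink _ _ n (≡.subst (ℕ._≤ suc n) (cong (length u ℕ.+_) (LP.length-++ u)) size))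
                                     (LP.++-cancelˡ u _ _ (trans uv (LP.++-assoc u w u))))
... | no u≰v with w , refl ← prefix v u u v (sym uv) (ℕP.<⇒≤ (ℕP.≰⇒> u≰v)) =
  powers-swap (powers-extend (commuting-powers′ n v w
    (shrink _ _ n (≡.subst (ℕ._≤ suc n) (trans (cong (ℕ._+ length v) (LP.length-++ v)) (ℕP.+-comm _ (length v))) size))
    (LP.++-cancelˡ v _ _ (trans (sym uv) (LP.++-assoc v w v)))))
commuting-powers′ zero (_ ∷ _) (_ ∷ _) () _

commuting-powers : (u v : List A) → u ++ v ≡ v ++ u → Powers u v
commuting-powers u v = commuting-powers′ _ u v ℕP.≤-refl

-- The quadratic equation  x a b y = y a b x.

a b : Fin 2
a = zero
b = suc zero

X Y : Fin 2
X = zero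
Y = suc zero

ab : List (Fin 2)
ab = a ∷ b ∷ []

E : WordEquation 2 2
E = (inj₂ X ∷ inj₁ a ∷ inj₁ b ∷ inj₂ Y ∷ []) ≐ (inj₂ Y ∷ inj₁ a ∷ inj₁ b ∷ inj₂ X ∷ [])

E-quadratic : Quadratic E
E-quadratic zero = ℕP.≤-refl
E-quadratic (suc zero) = ℕP.≤-refl

solution-words : (σ : Assignment 2 2) → IsSolution E σ → σ X ++ ab ++ σ Y ≡ σ Y ++ ab ++ σ X
solution-words σ sol =
  ≡.subst₂ (λ u v → σ X ++ a ∷ b ∷ u ≡ σ Y ++ a ∷ b ∷ v) (LP.++-identityʳ (σ Y)) (LP.++-identityʳ (σ X)) sol

-- In a solution of  x a b y = y a b x, the words  x a b  and  y a b  commute; a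
-- common root of them is at least two letters long (it ends the word with a b),
-- so |x| + 2 and |y| + 2 have a common divisor d ≥ 2.
common-divisor : ∀ (u v : List (Fin 2)) → u ++ ab ++ v ≡ v ++ ab ++ u →
                 Σ ℕ λ d → 2 ℕ.≤ d × d ℕD.∣ 2 ℕ.+ length u × d ℕD.∣ 2 ℕ.+ length v
common-divisor u v uv with commuting-powers (u ++ ab) (v ++ ab) commute
  where
  regroup : ∀ u v → (u ++ ab) ++ (v ++ ab) ≡ (u ++ ab ++ v) ++ ab
  regroup u v = trans (LP.++-assoc u ab (v ++ ab)) (sym (LP.++-assoc u (ab ++ v) ab))
  commute : (u ++ ab) ++ (v ++ ab) ≡ (v ++ ab) ++ (u ++ ab)
  commute = trans (regroup u v) (trans (cong (_++ ab) uv) (sym (regroup v u)))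
... | t , i , j , u≡ , v≡ = length t , root-long t u≡ v≡ , divides-length u i u≡ , divides-length v j v≡
  where
  length+2 : ∀ w → length (w ++ ab) ≡ 2 ℕ.+ length w
  length+2 w = trans (LP.length-++ w) (ℕP.+-comm (length w) 2)
  divides-length : ∀ w k → w ++ ab ≡ t ^ʷ k → length t ℕD.∣ 2 ℕ.+ length w
  divides-length w k w≡ = ℕD.divides k (trans (sym (length+2 w)) (trans (cong length w≡) (length-^ʷ t k)))
  root-long : ∀ t → u ++ ab ≡ t ^ʷ i → v ++ ab ≡ t ^ʷ j → 2 ℕ.≤ length t
  root-long [] _ v≡ =
    ⊥-elim (ℕP.1+n≢0 (trans (sym (length+2 v)) (trans (cong length v≡) (trans (length-^ʷ [] j) (ℕP.*-zeroʳ j)))))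
  root-long (c ∷ []) u≡ _ with refl ∷ () ∷ [] ← ++⁻ʳ u (≡.subst (All (_≡ c)) (sym u≡) (^ʷ-letter c i))
  root-long (_ ∷ _ ∷ _) _ _ = s≤s (s≤s z≤n)

prime-no-small-divisor : ∀ {p d} → Prime p → 2 ℕ.≤ d → d ℕ.< p → ¬ (d ℕD.∣ p)
prime-no-small-divisor p-prime 2≤d d<p d∣p =
  composite⇒¬prime (hasNonTrivialDivisor {{ℕ.n>1⇒nonTrivial 2≤d}} d<p d∣p) p-prime

-- If m + 2 is prime, no solution has |x| < |y| = m: a common divisor d ≥ 2 of
-- |x| + 2 and m + 2 would be at most |x| + 2 < m + 2.
Len-gap : ∀ n m → Prime (2 ℕ.+ m) → n ℕ.< m → ¬ Len E (n ∷ᵉ ⟨ m ⟩)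
Len-gap n m p-prime n<m (σ , sol , lengths)
  with d , 2≤d , d∣x+2 , d∣y+2 ← common-divisor (σ X) (σ Y) (solution-words σ sol)
  rewrite lengths X | lengths Y
  = prime-no-small-divisor p-prime 2≤d (ℕP.≤-<-trans (ℕD.∣⇒≤ d∣x+2) (s≤s (s≤s n<m))) d∣y+2

solution-family : List (Fin 2) → ℕ → Assignment 2 2
solution-family w P zero = w
solution-family w P (suc zero) = (w ++ ab) ^ʷ P ++ w

solution-family-solves : ∀ w P → IsSolution E (solution-family w P)
solution-family-solves w P = begin
    w ++ a ∷ b ∷ (y ++ [])        ≡⟨ cong (λ z → w ++ a ∷ b ∷ z) (LP.++-identityʳ y) ⟩
    w ++ ab ++ y                  ≡⟨ LP.++-assoc w ab y ⟨
    t ++ t ^ʷ P ++ w              ≡⟨ LP.++-assoc t (t ^ʷ P) w ⟨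
    (t ++ t ^ʷ P) ++ w            ≡⟨ cong (_++ w) (^ʷ-comm t P) ⟨
    (t ^ʷ P ++ t) ++ w            ≡⟨ LP.++-assoc (t ^ʷ P) t w ⟩
    t ^ʷ P ++ (w ++ ab) ++ w      ≡⟨ cong (t ^ʷ P ++_) (LP.++-assoc w ab w) ⟩
    t ^ʷ P ++ w ++ ab ++ w        ≡⟨ LP.++-assoc (t ^ʷ P) w (ab ++ w) ⟨
    y ++ a ∷ b ∷ w                ≡⟨ cong (λ z → y ++ a ∷ b ∷ z) (LP.++-identityʳ w) ⟨
    y ++ a ∷ b ∷ (w ++ [])        ∎
  where
  open ≡.≡-Reasoning
  t = w ++ ab
  y = t ^ʷ P ++ w

-- Hence (m, m + (m+2)·P) ∈ Len(E) for all m and P  (take w = a^m).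
solution-family-in-Len : ∀ m P → Len E (m ∷ᵉ ⟨ m ℕ.+ (2 ℕ.+ m) ℕ.* P ⟩)
solution-family-in-Len m P = solution-family w P , solution-family-solves w P , lengths
  where
  w = replicate m a
  reorder : ∀ m P → P ℕ.* (m ℕ.+ 2) ℕ.+ m ≡ m ℕ.+ (2 ℕ.+ m) ℕ.* P
  reorder = ℕR.solve-∀
  lengths : (v : Fin 2) → length (solution-family w P v) ≡ (m ∷ᵉ ⟨ m ℕ.+ (2 ℕ.+ m) ℕ.* P ⟩) v
  lengths zero = LP.length-replicate m
  lengths (suc zero) = begin
    length ((w ++ ab) ^ʷ P ++ w)                  ≡⟨ LP.length-++ ((w ++ ab) ^ʷ P) ⟩
    length ((w ++ ab) ^ʷ P) ℕ.+ length w          ≡⟨ cong₂ ℕ._+_ (length-^ʷ (w ++ ab) P) (LP.length-replicate m) ⟩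
    P ℕ.* length (w ++ ab) ℕ.+ m                  ≡⟨ cong (λ l → P ℕ.* l ℕ.+ m) (trans (LP.length-++ w) (cong (ℕ._+ 2) (LP.length-replicate m))) ⟩
    P ℕ.* (m ℕ.+ 2) ℕ.+ m                         ≡⟨ reorder m P ⟩
    m ℕ.+ (2 ℕ.+ m) ℕ.* P                         ∎
    where open ≡.≡-Reasoning

-- From a definition φ of a binary relation R: the set of those y with no n < y in relation R.
noSmallerPartner : Formula 2 → Formula 1
noSmallerPartner φ = `∀ (`¬ (((var zero `+ `1) `≤ var (suc zero)) `∧ φ))

-- If φ defined Len(E), the set S defined by  noSmallerPartner φ  would be
-- ultimately periodic, with threshold N and period P. S contains every m with
-- m + 2 prime (Len-gap) but not m + (m+2)·P (solution-family-in-Len), and such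
-- an m ≥ N exists.
Len-not-definable : ¬ PresburgerDefinable (Len E)
Len-not-definable (φ , φ-defines) = refute (presburger-periodic (noSmallerPartner φ))
  where
  S : ℕ → Set
  S y = ⟦ noSmallerPartner φ ⟧ ⟨ y ⟩
  -- no n < m is related to m, as m + 2 is prime
  no-partner : ∀ m → Prime (2 ℕ.+ m) → S m
  no-partner m p-prime n (n+1≤m , φ[n,m]) =
    Len-gap n m p-prime (≡.subst (ℕ._≤ m) (ℕP.+-comm n 1) n+1≤m) (proj₂ (φ-defines (n ∷ᵉ ⟨ m ⟩)) φ[n,m])
  partner : ∀ m P → 0 ℕ.< P → ¬ S (m ℕ.+ (2 ℕ.+ m) ℕ.* P)
  partner m P P>0 noPartner = noPartner m (m+1≤y , proj₁ (φ-defines (m ∷ᵉ ⟨ y ⟩)) (solution-family-in-Len m P))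
    where
    y = m ℕ.+ (2 ℕ.+ m) ℕ.* P
    m+1≤y : m ℕ.+ 1 ℕ.≤ y
    m+1≤y = ℕP.+-monoʳ-≤ m (ℕP.≤-trans P>0 (ℕP.m≤n*m P (2 ℕ.+ m)))
  refute : UltimatelyPeriodic S → ⊥
  refute (N , P , P>0 , periodic) with m , p-prime , N≤m ← prime-plus-two-above N =
    partner m P P>0 (to (periodic-multiple periodic (2 ℕ.+ m) m N≤m) (no-partner m p-prime))

theorem1 : Σ ℕ λ k → Σ ℕ λ n → Σ (WordEquation k n) λ E → Quadratic E × ¬ PresburgerDefinable (Len E)
theorem1 = 2 , 2 , E , E-quadratic , Len-not-definable
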